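{- Let $p\in\mathcal P$. Consider the relation on $p$-DF consisting of all pairs $\langle u,v\rangle$ with $u,v\in p$-DF such that either $u$ is a proper subterm of $v$, or $v$ is a term $a\circ b$ (i.e. $v=pa_0\cdots a_{n-1}\circ a_n$ with $a=pa_0\cdots a_{n-1}$, $b=a_n$) and $u$ is the term $I_k(a,b)$ for some $k\ge1$. The transitive closure $\prec^p$ of this relation is a well-founded partial ordering of $p$-DF.
   Context: $\mathcal P$ is the free algebra on one generator $x$ with two binary operations $\cdot$ (juxtaposition) and $\circ$, satisfying $a\circ(b\circ c)=(a\circ b)\circ c$, $(a\circ b)c=a(bc)$, $a(b\circ c)=ab\circ ac$, $a\circ b=ab\circ a$. Products are left-associated: $p_0p_1\cdots p_n=(\cdots(p_0p_1)\cdots)p_n$, $p_0\cdots p_{n-1}\circ p_n=(p_0\cdots p_{n-1})\circ p_n$, and $p_0\cdots p_{n-1}\ast p_n$ denotes either (same for formal terms). $p<_L q$ means $q=pa_0\cdots a_{n-1}\ast a_n$ for some $n\ge0$, $a_i\in\mathcal P$; $<_L$ is a linear order on $\mathcal P$, $\le_L$ is $<_L$ or $=$. Iterates: $I_1(a,b)=a$, $I_2(a,b)=ab$, $I_{n+2}(a,b)=I_{n+1}(a,b)I_n(a,b)$ (formed as terms). A term $b_0\cdots b_{n-1}\ast b_n$ is prenormal w.r.t. a linear order $\prec$ if $b_{k+2}\preceq b_0\cdots b_k$ for $0\le k\le n-2$, and if $\ast=\circ$ and $n\ge2$ also $b_n\prec b_0\cdots b_{n-2}$. For $p\in\mathcal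 P$, $p$-DF is the set of formal terms over the alphabet $\{q: q\le_L p\}$, with linear order $<_{\mathrm{Lex}}$, defined by simultaneous recursion: each $q\le_L p$ (length-one term) is in $p$-DF, these being ordered by $<_L$; a longer term is in $p$-DF iff it is $pa_0a_1\cdots a_{n-1}\ast a_n$ ($n\ge0$) with all $a_i\in p$-DF and the term prenormal w.r.t. $<_{\mathrm{Lex}}$; $<_{\mathrm{Lex}}$ is the lexicographic comparison of associated sequences (a proper initial segment is smaller), where the associated sequence of a length-one term $w$ is $\langle w\rangle$, of $pa_0\cdots a_n$ is $\langle p,a_0,\dots,a_n\rangle$, and of $pa_0\cdots a_{n-1}\circ a_n$ (with $u=pa_0\cdots a_{n-1}$) is $\langle p,a_0,\dots,a_n,I_1(u,a_n),I_2(u,a_n),\dots\rangle$. A term $u\circ a_n$ enters $p$-DF only after all the iterates $I_m(u,a_n)$ do, and $p$-DF is closed under subterms. -}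

module Defs where

open import Data.Nat using (ℕ; zero; suc; _<_)
open import Data.List using (List; []; _∷_; _∷ʳ_; foldl)
open import Data.Maybe using (Maybe; just; nothing)
open import Data.Product using (Σ; ∃; _×_; _,_; proj₁)
open import Data.Sum using (_⊎_)
open import Data.Empty using (⊥)
open import Relation.Binary.PropositionalEquality using (_≡_)

-- The free algebra 𝒫 on one generator, as a setoid of terms modulo the
-- congruence generated by the four defining identities.

data Op : Set where
  dot circ : Op          -- dot = juxtaposition ·, circ = ∘

data Tm : Set where
  gen  : Tm
  node : Op → Tm → Tm → Tm

infix 4 _≈_
data _≈_ : Tm → Tm → Set where
  ≈-refl  : ∀ {a} → a ≈ a
  ≈-sym   : ∀ {a b} → a ≈ b → b ≈ a
  ≈-trans : ∀ {a b c} → a ≈ b → b ≈ c → a ≈ c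
  ≈-cong  : ∀ o {a a′ b b′} → a ≈ a′ → b ≈ b′ → node o a b ≈ node o a′ b′
  ax1 : ∀ a b c → node circ a (node circ b c) ≈ node circ (node circ a b) c
  ax2 : ∀ a b c → node dot (node circ a b) c ≈ node dot a (node dot b c)
  ax3 : ∀ a b c → node dot a (node circ b c) ≈ node circ (node dot a b) (node dot a c)
  ax4 : ∀ a b → node circ a b ≈ node circ (node dot a b) a

prod : Tm → List Tm → Tm
prod = foldl (node dot)

_<L_ : Tm → Tm → Set
p <L q = Σ (List Tm) λ as → Σ Op λ o → Σ Tm λ a → q ≈ node o (prod p as) a

_≤L_ : Tm → Tm → Set
p ≤L q = p <L q ⊎ p ≈ q

data FTm : Set where
  leaf  : Tm → FTm
  fnode : Op → FTm → FTm → FTm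

infix 4 _≋_
data _≋_ : FTm → FTm → Set where
  leaf≋ : ∀ {q q′} → q ≈ q′ → leaf q ≋ leaf q′
  node≋ : ∀ o {s s′ t t′} → s ≋ s′ → t ≋ t′ → fnode o s t ≋ fnode o s′ t′

-- formal iterates: I n a b = I_{n+1}(a,b)
I : ℕ → FTm → FTm → FTm
I zero          a b = a
I (suc zero)    a b = fnode dot a b
I (suc (suc n)) a b = fnode dot (I (suc n) a b) (I n a b)

dotSpine : FTm → Maybe (Tm × List FTm)
dotSpine (leaf w) = just (w , [])
dotSpine (fnode dot u a) with dotSpine u
... | just (h , as) = just (h , as ∷ʳ a)
... | nothing       = nothing
dotSpine (fnode circ u a) = nothing

-- sequences (finite or infinite) as ℕ → Maybe A (nothing = past the end)
_!?_ : {A : Set} → List A → ℕ → Maybe A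
[]       !? i     = nothing
(x ∷ xs) !? zero  = just x
(x ∷ xs) !? suc i = xs !? i

_⊕_ : {A : Set} → List A → (ℕ → Maybe A) → ℕ → Maybe A
([]     ⊕ f) i       = f i
((x ∷ xs) ⊕ f) zero  = just x
((x ∷ xs) ⊕ f) (suc i) = (xs ⊕ f) i

assoc : FTm → ℕ → Maybe FTm
assoc (leaf w) = (leaf w ∷ []) !?_
assoc (fnode dot u a) with dotSpine (fnode dot u a)
... | just (h , as) = (leaf h ∷ as) !?_
... | nothing       = λ _ → nothing
assoc (fnode circ u a) with dotSpine u
... | just (h , as) = ((leaf h ∷ as) ∷ʳ a) ⊕ (λ k → just (I k u a))
... | nothing       = λ _ → nothing

Agree : FTm → FTm → Set
Agree = _≋_

AgreeM : Maybe FTm → Maybe FTm → Set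
AgreeM (just x) (just y) = Agree x y
AgreeM _        _        = ⊥

data LexSeq (R : FTm → FTm → Set) (s t : ℕ → Maybe FTm) : Set where
  differ : (i : ℕ) → (∀ j → j < i → AgreeM (s j) (t j)) →
           (x y : FTm) → s i ≡ just x → t i ≡ just y → R x y → LexSeq R s t
  prefix : (i : ℕ) → (∀ j → j < i → AgreeM (s j) (t j)) →
           (y : FTm) → s i ≡ nothing → t i ≡ just y → LexSeq R s t

infix 4 _<Lex_
data _<Lex_ : FTm → FTm → Set where
  base : ∀ {q q′} → q <L q′ → leaf q <Lex leaf q′
  lex  : ∀ {u v} → LexSeq _<Lex_ (assoc u) (assoc v) → u <Lex v

_≤Lex_ : FTm → FTm → Set
u ≤Lex v = u <Lex v ⊎ u ≋ v

-- Sp p s : s is a prenormal term p a₀ ⋯ a_{k} (k ≥ -1) with all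
-- aᵢ ∈ p-DF.  Prenormality of b₀ ⋯ b_{n-1} ∗ b_n is expressed locally:
-- whenever b₀ ⋯ b_{n-1} = r · d, the last factor c = b_n satisfies c ⪯ r
-- (strictly, if ∗ = ∘).

CondLe : FTm → FTm → Set
CondLe s c = ∀ r d → s ≡ fnode dot r d → c ≤Lex r

CondLt : FTm → FTm → Set
CondLt s c = ∀ r d → s ≡ fnode dot r d → c <Lex r

mutual
  data Sp (p : Tm) : FTm → Set where
    sp-head : ∀ {q} → q ≈ p → Sp p (leaf q)
    sp-dot  : ∀ {s c} → Sp p s → DF p c → CondLe s c → Sp p (fnode dot s c)

  data DF (p : Tm) : FTm → Set where
    df-leaf : ∀ {q} → q ≤L p → DF p (leaf q)
    df-dot  : ∀ {s c} → Sp p s → DF p c → CondLe s c → DF p (fnode dot s c)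
    df-circ : ∀ {s c} → Sp p s → DF p c → CondLt s c → DF p (fnode circ s c)

infix 4 _⊏_
data _⊏_ : FTm → FTm → Set where
  here-l  : ∀ {u o l r} → u ≋ l → u ⊏ fnode o l r
  here-r  : ∀ {u o l r} → u ≋ r → u ⊏ fnode o l r
  there-l : ∀ {u o l r} → u ⊏ l → u ⊏ fnode o l r
  there-r : ∀ {u o l r} → u ⊏ r → u ⊏ fnode o l r

DFset : Tm → Set
DFset p = Σ FTm (DF p)

_≋ᵖ_ : ∀ {p} → DFset p → DFset p → Set
u ≋ᵖ v = proj₁ u ≋ proj₁ v

Rᵖ : ∀ {p} → DFset p → DFset p → Set
Rᵖ (u , _) (v , _) =
  u ⊏ v ⊎ Σ FTm λ a → Σ FTm λ b → v ≡ fnode circ a b × ∃ λ k → u ≋ I k a b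

{-# OPTIONS --safe #-}
module Submission where

open import Defs
open import Data.Product using (_×_)
open import Relation.Binary.Structures using (IsStrictPartialOrder)
open import Relation.Binary.Construct.Closure.Transitive using (TransClosure)
open import Induction.WellFounded using (WellFounded)

open import Level using (0ℓ)
open import Function using (_∘_; _on_)
open import Data.Nat using (ℕ; zero; suc; _<_; _≤_; _⊔_; _+_; s≤s)
open import Data.Nat.Properties
open import Data.Nat.Induction using (<-wellFounded)
open import Data.Product using (Σ; ∃; _,_; proj₁)
open import Data.Product.Relation.Binary.Pointwise.NonDependent using (Pointwise)
open import Data.Product.Relation.Binary.Lex.Strict
  using (×-Lex; ×-isStrictPartialOrder; ×-wellFounded)
open import Data.Sum using (_⊎_; inj₁; inj₂)
open import Relation.Binary.Core using (Rel; _⇒_)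
open import Relation.Binary.Definitions using (Transitive; _Respectsˡ_; _Respectsʳ_)
open import Relation.Binary.Structures using (IsEquivalence)
open import Relation.Binary.PropositionalEquality using (_≡_; refl; cong; cong₂)
open import Relation.Binary.Construct.Closure.Transitive using ([_]; _∷_; _++_)
import Relation.Binary.Construct.Closure.Transitive as Transitive
import Relation.Binary.Construct.On as On
open Induction.WellFounded using (module Subrelation)

-- Every basic step strictly decreases the pair (∘-depth, size) lexicographically:
-- a proper subterm has no greater ∘-depth and smaller size, while the iterates
-- I_k(a,b) are built from a and b by juxtaposition alone, so their ∘-depth is
-- below that of a ∘ b.

module _ {a ℓ} {A : Set a} {_∼_ : Rel A ℓ} where

  ⁺-respˡ : ∀ {ℓ′} {_≈_ : Rel A ℓ′} → _∼_ Respectsˡ _≈_ → TransClosure _∼_ Respectsˡ _≈_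
  ⁺-respˡ resp x≈y [ x∼z ]       = [ resp x≈y x∼z ]
  ⁺-respˡ resp x≈y (x∼w ∷ w∼⁺z) = resp x≈y x∼w ∷ w∼⁺z

  ⁺-respʳ : ∀ {ℓ′} {_≈_ : Rel A ℓ′} → _∼_ Respectsʳ _≈_ → TransClosure _∼_ Respectsʳ _≈_
  ⁺-respʳ resp y≈z [ x∼y ]       = [ resp y≈z x∼y ]
  ⁺-respʳ resp y≈z (x∼w ∷ w∼⁺y) = x∼w ∷ ⁺-respʳ resp y≈z w∼⁺y

  ⁺-⇒ : ∀ {ℓ′} {_≺_ : Rel A ℓ′} → _∼_ ⇒ _≺_ → Transitive _≺_ → TransClosure _∼_ ⇒ _≺_
  ⁺-⇒ ∼⇒≺ trans [ x∼y ]       = ∼⇒≺ x∼y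
  ⁺-⇒ ∼⇒≺ trans (x∼w ∷ w∼⁺y) = trans (∼⇒≺ x∼w) (⁺-⇒ ∼⇒≺ trans w∼⁺y)

infix 4 _<ₗₑₓ_
_<ₗₑₓ_ : Rel (ℕ × ℕ) 0ℓ
_<ₗₑₓ_ = ×-Lex _≡_ _<_ _<_

<ₗₑₓ-isStrictPartialOrder : IsStrictPartialOrder (Pointwise _≡_ _≡_) _<ₗₑₓ_
<ₗₑₓ-isStrictPartialOrder =
  ×-isStrictPartialOrder <-isStrictPartialOrder <-isStrictPartialOrder

open IsStrictPartialOrder <ₗₑₓ-isStrictPartialOrder
  using () renaming (irrefl to <ₗₑₓ-irrefl; trans to <ₗₑₓ-trans)

<ₗₑₓ-wellFounded : WellFounded _<ₗₑₓ_
<ₗₑₓ-wellFounded = ×-wellFounded <-wellFounded <-wellFounded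

≤×<⇒<ₗₑₓ : ∀ {m m′ n n′} → m ≤ m′ → n < n′ → (m , n) <ₗₑₓ (m′ , n′)
≤×<⇒<ₗₑₓ m≤m′ n<n′ with m≤n⇒m<n∨m≡n m≤m′
... | inj₁ m<m′ = inj₁ m<m′
... | inj₂ m≡m′ = inj₂ (m≡m′ , n<n′)

≋-refl : ∀ {t} → t ≋ t
≋-refl {leaf q}      = leaf≋ ≈-refl
≋-refl {fnode o s t} = node≋ o ≋-refl ≋-refl

≋-sym : ∀ {s t} → s ≋ t → t ≋ s
≋-sym (leaf≋ q≈q′)    = leaf≋ (≈-sym q≈q′)
≋-sym (node≋ o s≋ t≋) = node≋ o (≋-sym s≋) (≋-sym t≋)

≋-trans : ∀ {s t u} → s ≋ t → t ≋ u → s ≋ u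
≋-trans (leaf≋ e)       (leaf≋ f)        = leaf≋ (≈-trans e f)
≋-trans (node≋ o s₁ t₁) (node≋ .o s₂ t₂) = node≋ o (≋-trans s₁ s₂) (≋-trans t₁ t₂)

≋-isEquivalence : IsEquivalence _≋_
≋-isEquivalence = record { refl = ≋-refl ; sym = ≋-sym ; trans = ≋-trans }

I-cong : ∀ k {a a′ b b′} → a ≋ a′ → b ≋ b′ → I k a b ≋ I k a′ b′
I-cong zero          a≋ b≋ = a≋
I-cong (suc zero)    a≋ b≋ = node≋ dot a≋ b≋
I-cong (suc (suc k)) a≋ b≋ = node≋ dot (I-cong (suc k) a≋ b≋) (I-cong k a≋ b≋)

⊏-respˡ-≋ : _⊏_ Respectsˡ _≋_
⊏-respˡ-≋ u≋u′ (here-l u≋l)  = here-l (≋-trans (≋-sym u≋u′) u≋l)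
⊏-respˡ-≋ u≋u′ (here-r u≋r)  = here-r (≋-trans (≋-sym u≋u′) u≋r)
⊏-respˡ-≋ u≋u′ (there-l u⊏l) = there-l (⊏-respˡ-≋ u≋u′ u⊏l)
⊏-respˡ-≋ u≋u′ (there-r u⊏r) = there-r (⊏-respˡ-≋ u≋u′ u⊏r)

⊏-respʳ-≋ : _⊏_ Respectsʳ _≋_
⊏-respʳ-≋ (node≋ o l≋ r≋) (here-l u≋l)  = here-l (≋-trans u≋l l≋)
⊏-respʳ-≋ (node≋ o l≋ r≋) (here-r u≋r)  = here-r (≋-trans u≋r r≋)
⊏-respʳ-≋ (node≋ o l≋ r≋) (there-l u⊏l) = there-l (⊏-respʳ-≋ l≋ u⊏l)
⊏-respʳ-≋ (node≋ o l≋ r≋) (there-r u⊏r) = there-r (⊏-respʳ-≋ r≋ u⊏r)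

circDepth : FTm → ℕ
circDepth (leaf _)         = 0
circDepth (fnode dot l r)  = circDepth l ⊔ circDepth r
circDepth (fnode circ l r) = suc (circDepth l ⊔ circDepth r)

size : FTm → ℕ
size (leaf _)      = 0
size (fnode _ l r) = suc (size l + size r)

rank : FTm → ℕ × ℕ
rank t = circDepth t , size t

circDepth-cong : ∀ {s t} → s ≋ t → circDepth s ≡ circDepth t
circDepth-cong (leaf≋ _)          = refl
circDepth-cong (node≋ dot l≋ r≋)  = cong₂ _⊔_ (circDepth-cong l≋) (circDepth-cong r≋)
circDepth-cong (node≋ circ l≋ r≋) = cong suc (cong₂ _⊔_ (circDepth-cong l≋) (circDepth-cong r≋))

size-cong : ∀ {s t} → s ≋ t → size s ≡ size t
size-cong (leaf≋ _)       = refl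
size-cong (node≋ o l≋ r≋) = cong suc (cong₂ _+_ (size-cong l≋) (size-cong r≋))

rank-cong : ∀ {s t} → s ≋ t → Pointwise _≡_ _≡_ (rank s) (rank t)
rank-cong s≋t = circDepth-cong s≋t , size-cong s≋t

circDepth-⊔≤ : ∀ o l r → circDepth l ⊔ circDepth r ≤ circDepth (fnode o l r)
circDepth-⊔≤ dot  l r = ≤-refl
circDepth-⊔≤ circ l r = n≤1+n _

circDepth-≤ˡ : ∀ o l r → circDepth l ≤ circDepth (fnode o l r)
circDepth-≤ˡ o l r = ≤-trans (m≤m⊔n (circDepth l) (circDepth r)) (circDepth-⊔≤ o l r)

circDepth-≤ʳ : ∀ o l r → circDepth r ≤ circDepth (fnode o l r)
circDepth-≤ʳ o l r = ≤-trans (m≤n⊔m (circDepth l) (circDepth r)) (circDepth-⊔≤ o l r)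

size-<ˡ : ∀ o l r → size l < size (fnode o l r)
size-<ˡ o l r = s≤s (m≤m+n (size l) (size r))

size-<ʳ : ∀ o l r → size r < size (fnode o l r)
size-<ʳ o l r = s≤s (m≤n+m (size r) (size l))

⊏⇒circDepth≤ : ∀ {u v} → u ⊏ v → circDepth u ≤ circDepth v
⊏⇒circDepth≤ (here-l {o = o} {l} {r} u≋l)  = ≤-trans (≤-reflexive (circDepth-cong u≋l)) (circDepth-≤ˡ o l r)
⊏⇒circDepth≤ (here-r {o = o} {l} {r} u≋r)  = ≤-trans (≤-reflexive (circDepth-cong u≋r)) (circDepth-≤ʳ o l r)
⊏⇒circDepth≤ (there-l {o = o} {l} {r} u⊏l) = ≤-trans (⊏⇒circDepth≤ u⊏l) (circDepth-≤ˡ o l r)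
⊏⇒circDepth≤ (there-r {o = o} {l} {r} u⊏r) = ≤-trans (⊏⇒circDepth≤ u⊏r) (circDepth-≤ʳ o l r)

⊏⇒size< : ∀ {u v} → u ⊏ v → size u < size v
⊏⇒size< (here-l {o = o} {l} {r} u≋l)  = ≤-<-trans (≤-reflexive (size-cong u≋l)) (size-<ˡ o l r)
⊏⇒size< (here-r {o = o} {l} {r} u≋r)  = ≤-<-trans (≤-reflexive (size-cong u≋r)) (size-<ʳ o l r)
⊏⇒size< (there-l {o = o} {l} {r} u⊏l) = <-trans (⊏⇒size< u⊏l) (size-<ˡ o l r)
⊏⇒size< (there-r {o = o} {l} {r} u⊏r) = <-trans (⊏⇒size< u⊏r) (size-<ʳ o l r)

⊏⇒rank< : ∀ {u v} → u ⊏ v → rank u <ₗₑₓ rank v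
⊏⇒rank< u⊏v = ≤×<⇒<ₗₑₓ (⊏⇒circDepth≤ u⊏v) (⊏⇒size< u⊏v)

circDepth-I : ∀ k a b → circDepth (I k a b) ≤ circDepth a ⊔ circDepth b
circDepth-I zero          a b = m≤m⊔n (circDepth a) (circDepth b)
circDepth-I (suc zero)    a b = ≤-refl
circDepth-I (suc (suc k)) a b = ⊔-lub (circDepth-I (suc k) a b) (circDepth-I k a b)

I-rank< : ∀ {u} k a b → u ≋ I k a b → rank u <ₗₑₓ rank (fnode circ a b)
I-rank< k a b u≋I = inj₁ (s≤s (≤-trans (≤-reflexive (circDepth-cong u≋I)) (circDepth-I k a b)))

-- Rᵖ is definitionally _◁_ on proj₁, so the lemmas below apply to Rᵖ directly.
infix 4 _◁_
_◁_ : Rel FTm 0ℓ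
u ◁ v = u ⊏ v ⊎ Σ FTm λ a → Σ FTm λ b → v ≡ fnode circ a b × ∃ λ k → u ≋ I k a b

◁⇒rank< : ∀ {u v} → u ◁ v → rank u <ₗₑₓ rank v
◁⇒rank< (inj₁ u⊏v)                     = ⊏⇒rank< u⊏v
◁⇒rank< (inj₂ (a , b , refl , k , u≋I)) = I-rank< k a b u≋I

◁-respˡ : _◁_ Respectsˡ _≋_
◁-respˡ u≋u′ (inj₁ u⊏v)                   = inj₁ (⊏-respˡ-≋ u≋u′ u⊏v)
◁-respˡ u≋u′ (inj₂ (a , b , v≡ , k , u≋I)) = inj₂ (a , b , v≡ , k , ≋-trans (≋-sym u≋u′) u≋I)

◁-respʳ : _◁_ Respectsʳ _≋_
◁-respʳ v≋v′ (inj₁ u⊏v) = inj₁ (⊏-respʳ-≋ v≋v′ u⊏v)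
◁-respʳ (node≋ circ a≋ b≋) (inj₂ (a , b , refl , k , u≋I)) =
  inj₂ (_ , _ , refl , k , ≋-trans u≋I (I-cong k a≋ b≋))

lemma3 : (p : Tm) →
    IsStrictPartialOrder (_≋ᵖ_ {p}) (TransClosure (Rᵖ {p}))
    × WellFounded (TransClosure (Rᵖ {p}))
lemma3 p = isStrictPartialOrder , wellFounded
  where
  _<ʳ_ : Rel (DFset p) 0ℓ
  _<ʳ_ = _<ₗₑₓ_ on (rank ∘ proj₁)

  ⁺Rᵖ⇒<ʳ : TransClosure (Rᵖ {p}) ⇒ _<ʳ_
  ⁺Rᵖ⇒<ʳ = ⁺-⇒ ◁⇒rank< <ₗₑₓ-trans

  isStrictPartialOrder : IsStrictPartialOrder (_≋ᵖ_ {p}) (TransClosure (Rᵖ {p}))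
  isStrictPartialOrder = record
    { isEquivalence = On.isEquivalence proj₁ ≋-isEquivalence
    ; irrefl        = λ u≋v u≺v → <ₗₑₓ-irrefl (rank-cong u≋v) (⁺Rᵖ⇒<ʳ u≺v)
    ; trans         = _++_
    ; <-resp-≈      = ⁺-respʳ ◁-respʳ , ⁺-respˡ ◁-respˡ
    }

  wellFounded : WellFounded (TransClosure (Rᵖ {p}))
  wellFounded = Transitive.wellFounded Rᵖ
    (Subrelation.wellFounded ◁⇒rank< (On.wellFounded (rank ∘ proj₁) <ₗₑₓ-wellFounded))
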